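{- Let $G$ be a graph with $n$ vertices and $m$ edges, where $m\ge 20$. Then $\mathrm{ISO}(G)\ge \frac{m^2}{5n^2}$.
   Context: For a graph $G$, $\mathrm{ISO}(G)$ is the largest integer $s$ such that $G$ contains a pair of edge-disjoint isomorphic subgraphs with $s$ edges each. -}

module Defs where

open import Data.Nat using (ℕ; _*_; _≤_)
open import Data.Fin using (Fin; _<_)
open import Data.Product using (_×_; _,_; Σ; ∃; ∃-syntax)
open import Data.Sum using (_⊎_)
open import Data.List using (List; length)
open import Data.List.Relation.Unary.All using (All)
open import Data.List.Relation.Unary.Unique.Propositional using (Unique)
open import Data.List.Membership.Propositional using (_∈_; _∉_)
open import Relation.Binary.PropositionalEquality using (_≡_)
open import Function.Bundles using (_↔_; _⇔_; Inverse)

-- Each edge {u,v} is stored once as the ordered pair (u , v) with u < v,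
-- and the list has no duplicates.
record Graph (n : ℕ) : Set where
  field
    edges   : List (Fin n × Fin n)
    ordered : All (λ e → Data.Product.proj₁ e < Data.Product.proj₂ e) edges
    unique  : Unique edges
open Graph public

numEdges : ∀ {n} → Graph n → ℕ
numEdges G = length (edges G)

_∈ₑ_ : ∀ {n} → Fin n × Fin n → List (Fin n × Fin n) → Set
(u , v) ∈ₑ H = ((u , v) ∈ H) ⊎ ((v , u) ∈ H)

IsEdgeSubset : ∀ {n} → List (Fin n × Fin n) → Graph n → Set
IsEdgeSubset H G = Unique H × All (_∈ edges G) H

EdgeDisjoint : ∀ {n} → List (Fin n × Fin n) → List (Fin n × Fin n) → Set
EdgeDisjoint H₁ H₂ = All (_∉ H₂) H₁

-- The (edge-defined) subgraphs H₁ and H₂ of a graph on Fin n are isomorphic: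
-- some bijection of the vertex set maps the edges of H₁ exactly onto those of H₂.
-- (Any isomorphism between the subgraphs extends to a permutation of Fin n.)
Isomorphic : ∀ {n} → List (Fin n × Fin n) → List (Fin n × Fin n) → Set
Isomorphic {n} H₁ H₂ =
  Σ (Fin n ↔ Fin n) λ σ →
    ∀ u v → ((u , v) ∈ₑ H₁) ⇔ ((Inverse.to σ u , Inverse.to σ v) ∈ₑ H₂)

HasIsoPair : ∀ {n} → Graph n → ℕ → Set
HasIsoPair {n} G s =
  Σ (List (Fin n × Fin n)) λ H₁ → Σ (List (Fin n × Fin n)) λ H₂ →
    IsEdgeSubset H₁ G × IsEdgeSubset H₂ G × EdgeDisjoint H₁ H₂ ×
    Isomorphic H₁ H₂ × (length H₁ ≡ s) × (length H₂ ≡ s)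

module Submission where

-- Identify the vertex set with ℤ/n.  For each k the reflection x ↦ k − x is
-- an involution of the vertices; the edges it moves onto other edges come in
-- pairs {e , σe}, and keeping the lexicographically smaller (or larger) edge
-- of each pair yields a subgraph that is edge-disjoint from and isomorphic to
-- its reflection.  So if the reflection about k moves c_k edges, ISO(G) ≥ c_k/2.
-- Double counting bounds T = ∑_k c_k from below: group the edges by their
-- difference v − u; two distinct edges with the same difference are swapped
-- by some reflection, so with a_δ edges of difference δ, Cauchy–Schwarz gives
-- m² ≤ n ∑ a_δ² ≤ n (T + m).  Choosing the best k, m² ≤ n(2n·ISO(G) + m),
-- which gives the bound when 5n ≤ 3m; otherwise two distinct edges already
-- form an isomorphic pair of size 1 and m² ≤ 5n² holds trivially.

open import Defs

open import Level using (0ℓ)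
open import Function using (_∘_; flip; id)
open import Function.Bundles using (mk⇔)
open import Data.Empty using (⊥; ⊥-elim)
open import Data.Sum as Sum using (_⊎_; inj₁; inj₂)
open import Data.Product using (_×_; _,_; proj₁; proj₂; swap; Σ; ∃-syntax)
open import Data.Product.Properties using (≡-dec)
open import Data.Product.Relation.Binary.Lex.Strict using (×-Lex; ×-decidable; ×-asymmetric; ×-compare)
open import Data.Product.Relation.Binary.Pointwise.NonDependent using (≡×≡⇒≡)
open import Data.Nat
open import Data.Nat.Properties
open import Data.Nat.Tactic.RingSolver using (solve-∀)
open import Algebra.Properties.CommutativeSemigroup +-commutativeSemigroup using (interchange)
open import Data.Fin as Fin using (Fin; toℕ; fromℕ<)
open import Data.Fin.Properties as FinP using (toℕ-injective; toℕ<n; toℕ-fromℕ<)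
open import Data.Fin.Permutation using (Permutation′; permutation; _⟨$⟩ʳ_; _⟨$⟩ˡ_; inverseˡ; transpose; _∘ₚ_)
import Data.Fin.Permutation.Components as PC
open import Data.List using (List; []; _∷_; length; filter; map; allFin; tabulate)
open import Data.List.Properties using (length-map; length-tabulate)
open import Data.List.Relation.Unary.Any using (here; there)
open import Data.List.Relation.Unary.All as All using ([]; _∷_)
import Data.List.Relation.Unary.All.Properties as All
open import Data.List.Relation.Unary.AllPairs using ([]; _∷_)
open import Data.List.Relation.Unary.Unique.Propositional using (Unique)
open import Data.List.Relation.Unary.Unique.Propositional.Properties using (filter⁺; allFin⁺)
open import Data.List.Membership.Propositional using (_∈_; _∉_)
open import Data.List.Membership.Propositional.Properties using (∈-map⁺; ∈-map⁻; ∈-filter⁻; ∈-allFin)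
open import Relation.Binary.Core using (Rel)
open import Relation.Binary.Definitions using (DecidableEquality; Asymmetric; tri<; tri≈; tri>)
  renaming (Decidable to Decidable₂)
open import Relation.Binary.PropositionalEquality
open import Relation.Nullary using (Dec; yes; no)
open import Relation.Nullary.Decidable using (¬?; _×-dec_)
open import Relation.Unary using (Decidable)

𝟙 : ∀ {p} {P : Set p} → Dec P → ℕ
𝟙 (yes _) = 1
𝟙 (no _)  = 0

𝟙≤1 : ∀ {p} {P : Set p} (d : Dec P) → 𝟙 d ≤ 1
𝟙≤1 (yes _) = ≤-refl
𝟙≤1 (no _)  = z≤n

𝟙-yes : ∀ {p} {P : Set p} (d : Dec P) → P → 𝟙 d ≡ 1
𝟙-yes (yes _) _ = refl
𝟙-yes (no ¬p) p = ⊥-elim (¬p p)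

𝟙-mono : ∀ {p q} {P : Set p} {Q : Set q} (dp : Dec P) (dq : Dec Q) → (P → Q) → 𝟙 dp ≤ 𝟙 dq
𝟙-mono (yes p) dq f = ≤-reflexive (sym (𝟙-yes dq (f p)))
𝟙-mono (no _)  dq f = z≤n

𝟙-× : ∀ {p q} {P : Set p} {Q : Set q} (dp : Dec P) (dq : Dec Q) → 𝟙 (dp ×-dec dq) ≡ 𝟙 dp * 𝟙 dq
𝟙-× (yes _) (yes _) = refl
𝟙-× (yes _) (no _)  = refl
𝟙-× (no _)  dq      = refl

𝟙-⊎ : ∀ {p q r} {P : Set p} {Q : Set q} {R : Set r} (dp : Dec P) (dq : Dec Q) (dr : Dec R) →
      (P → Q ⊎ R) → 𝟙 dp ≤ 𝟙 dq + 𝟙 dr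
𝟙-⊎ (no _)  dq dr f = z≤n
𝟙-⊎ (yes p) dq dr f with f p
... | inj₁ q = ≤-trans (≤-reflexive (sym (𝟙-yes dq q))) (m≤m+n (𝟙 dq) (𝟙 dr))
... | inj₂ r = ≤-trans (≤-reflexive (sym (𝟙-yes dr r))) (m≤n+m (𝟙 dr) (𝟙 dq))

𝟙-split : ∀ {p q} {P : Set p} {Q : Set q} (dp : Dec P) (dq : Dec Q) → 𝟙 dp ≤ 𝟙 dp * 𝟙 (¬? dq) + 𝟙 dq
𝟙-split dp (yes _) = ≤-trans (𝟙≤1 dp) (m≤n+m 1 _)
𝟙-split dp (no _)  = ≤-trans (≤-reflexive (sym (*-identityʳ (𝟙 dp)))) (m≤m+n _ _)

∑ : ∀ {a} {A : Set a} → List A → (A → ℕ) → ℕ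
∑ []       g = 0
∑ (x ∷ xs) g = g x + ∑ xs g

module _ {a} {A : Set a} where

  ∑-mono : (xs : List A) {g h : A → ℕ} → (∀ x → x ∈ xs → g x ≤ h x) → ∑ xs g ≤ ∑ xs h
  ∑-mono []       p = z≤n
  ∑-mono (x ∷ xs) p = +-mono-≤ (p x (here refl)) (∑-mono xs (λ y y∈ → p y (there y∈)))

  ∑-cong : (xs : List A) {g h : A → ℕ} → (∀ x → g x ≡ h x) → ∑ xs g ≡ ∑ xs h
  ∑-cong []       p = refl
  ∑-cong (x ∷ xs) p = cong₂ _+_ (p x) (∑-cong xs p)

  ∑-+ : (xs : List A) (g h : A → ℕ) → ∑ xs (λ x → g x + h x) ≡ ∑ xs g + ∑ xs h
  ∑-+ []       g h = refl
  ∑-+ (x ∷ xs) g h = trans (cong (g x + h x +_) (∑-+ xs g h)) (interchange (g x) (h x) (∑ xs g) (∑ xs h))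

  ∑-*ʳ : (xs : List A) (g : A → ℕ) (c : ℕ) → ∑ xs g * c ≡ ∑ xs (λ x → g x * c)
  ∑-*ʳ []       g c = refl
  ∑-*ʳ (x ∷ xs) g c = trans (*-distribʳ-+ c (g x) (∑ xs g)) (cong (g x * c +_) (∑-*ʳ xs g c))

  ∑-pick : (xs : List A) (g : A → ℕ) {x : A} → x ∈ xs → g x ≤ ∑ xs g
  ∑-pick (y ∷ xs) g (here refl) = m≤m+n (g y) (∑ xs g)
  ∑-pick (y ∷ xs) g (there x∈)  = ≤-trans (∑-pick xs g x∈) (m≤n+m (∑ xs g) (g y))

  ∑-zero : (xs : List A) → ∑ xs (λ _ → 0) ≡ 0
  ∑-zero []       = refl
  ∑-zero (x ∷ xs) = ∑-zero xs

  ∑-one : (xs : List A) → ∑ xs (λ _ → 1) ≡ length xs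
  ∑-one []       = refl
  ∑-one (x ∷ xs) = cong suc (∑-one xs)

  length-filter : ∀ {p} {P : A → Set p} (P? : Decidable P) (xs : List A) →
                  length (filter P? xs) ≡ ∑ xs (λ x → 𝟙 (P? x))
  length-filter P? []       = refl
  length-filter P? (x ∷ xs) with P? x
  ... | yes _ = cong suc (length-filter P? xs)
  ... | no _  = length-filter P? xs

  ∑-swap : ∀ {b} {B : Set b} (xs : List A) (ys : List B) (g : A → B → ℕ) →
           ∑ xs (λ x → ∑ ys (g x)) ≡ ∑ ys (λ y → ∑ xs (λ x → g x y))
  ∑-swap xs []       g = ∑-zero xs
  ∑-swap xs (y ∷ ys) g = trans (∑-+ xs (λ x → g x y) (λ x → ∑ ys (g x)))
                               (cong (∑ xs (λ x → g x y) +_) (∑-swap xs ys g))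

  module _ (_≟_ : DecidableEquality A) where
    open import Data.List.Membership.DecPropositional _≟_ using (_∈?_)

    ∑-delta : (xs : List A) → Unique xs → (x : A) (h : A → ℕ) →
              ∑ xs (λ y → 𝟙 (y ≟ x) * h y) ≤ 𝟙 (x ∈? xs) * h x
    ∑-delta []       _          x h = z≤n
    ∑-delta (y ∷ ys) (y∉ys ∷ u) x h with y ≟ x
    ... | yes refl = begin
      1 * h x + ∑ ys (λ z → 𝟙 (z ≟ x) * h z) ≤⟨ +-monoʳ-≤ (1 * h x) (∑-mono ys absent) ⟩
      1 * h x + ∑ ys (λ _ → 0)                ≡⟨ cong (1 * h x +_) (∑-zero ys) ⟩
      1 * h x + 0                             ≡⟨ +-identityʳ _ ⟩
      1 * h x                                 ≡⟨ cong (_* h x) (𝟙-yes (x ∈? (x ∷ ys)) (here refl)) ⟨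
      𝟙 (x ∈? (x ∷ ys)) * h x                 ∎
      where
      open ≤-Reasoning
      absent : ∀ z → z ∈ ys → 𝟙 (z ≟ x) * h z ≤ 0
      absent z z∈ys with z ≟ x
      ... | yes refl = ⊥-elim (All.lookup y∉ys z∈ys refl)
      ... | no _     = z≤n
    ... | no _ = ≤-trans (∑-delta ys u x h) (*-monoˡ-≤ (h x) (𝟙-mono (x ∈? ys) (x ∈? (y ∷ ys)) there))

am-gm : ∀ a b → 2 * (a * b) ≤ a * a + b * b
am-gm a b with ≤-total a b
... | inj₁ a≤b with m≤n⇒∃[o]m+o≡n a≤b
...   | t , refl = ≤-trans (m≤m+n _ (t * t)) (≤-reflexive (expand a t))
  where
  expand : ∀ a t → 2 * (a * (a + t)) + t * t ≡ a * a + (a + t) * (a + t)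
  expand = solve-∀
am-gm a b | inj₂ b≤a with m≤n⇒∃[o]m+o≡n b≤a
...   | t , refl = ≤-trans (m≤m+n _ (t * t)) (≤-reflexive (expand b t))
  where
  expand : ∀ b t → 2 * ((b + t) * b) + t * t ≡ (b + t) * (b + t) + b * b
  expand = solve-∀

-- The cross term in the inductive step of Cauchy–Schwarz: if S² ≤ nQ
-- then 2xS ≤ nx² + Q (multiply by n and apply AM–GM to nx and S).
cross-term : ∀ n x S Q → S * S ≤ n * Q → 2 * (x * S) ≤ n * (x * x) + Q
cross-term zero x S Q S²≤0 with Sum.reduce (m*n≡0⇒m≡0∨n≡0 S (n≤0⇒n≡0 S²≤0))
... | refl = ≤-trans (≤-reflexive (cong (2 *_) (*-zeroʳ x))) z≤n
cross-term n@(suc _) x S Q S²≤nQ = *-cancelˡ-≤ n (begin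
  n * (2 * (x * S))            ≡⟨ rearrange₁ n x S ⟩
  2 * ((n * x) * S)            ≤⟨ am-gm (n * x) S ⟩
  (n * x) * (n * x) + S * S    ≤⟨ +-monoʳ-≤ ((n * x) * (n * x)) S²≤nQ ⟩
  (n * x) * (n * x) + n * Q    ≡⟨ rearrange₂ n x Q ⟩
  n * (n * (x * x) + Q)        ∎)
  where
  open ≤-Reasoning
  rearrange₁ : ∀ n x S → n * (2 * (x * S)) ≡ 2 * ((n * x) * S)
  rearrange₁ = solve-∀
  rearrange₂ : ∀ n x Q → (n * x) * (n * x) + n * Q ≡ n * (n * (x * x) + Q)
  rearrange₂ = solve-∀

cauchy-schwarz : ∀ {a} {A : Set a} (xs : List A) (c : A → ℕ) →
                 ∑ xs c * ∑ xs c ≤ length xs * ∑ xs (λ x → c x * c x)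
cauchy-schwarz []       c = z≤n
cauchy-schwarz (x ∷ xs) c = begin
  (c x + S) * (c x + S)                 ≡⟨ expand (c x) S ⟩
  c x * c x + 2 * (c x * S) + S * S     ≤⟨ +-mono-≤ (+-monoʳ-≤ (c x * c x) (cross-term n (c x) S Q IH)) IH ⟩
  c x * c x + (n * (c x * c x) + Q) + n * Q ≡⟨ collect n (c x) Q ⟩
  suc n * (c x * c x + Q)               ∎
  where
  open ≤-Reasoning
  n S Q : ℕ
  n = length xs
  S = ∑ xs c
  Q = ∑ xs (λ y → c y * c y)
  IH : S * S ≤ n * Q
  IH = cauchy-schwarz xs c
  expand : ∀ a S → (a + S) * (a + S) ≡ a * a + 2 * (a * S) + S * S
  expand = solve-∀
  collect : ∀ n a Q → a * a + (n * (a * a) + Q) + n * Q ≡ suc n * (a * a + Q)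
  collect = solve-∀

∑≤length*max : ∀ {a} {A : Set a} (x : A) (xs : List A) (g : A → ℕ) →
               ∃[ k ] ∑ (x ∷ xs) g ≤ length (x ∷ xs) * g k
∑≤length*max x []       g = x , ≤-refl
∑≤length*max x (y ∷ ys) g with ∑≤length*max y ys g
... | k , h with ≤-total (g x) (g k)
...   | inj₁ gx≤gk = k , +-mono-≤ gx≤gk h
...   | inj₂ gk≤gx = x , +-monoʳ-≤ (g x) (≤-trans h (*-monoʳ-≤ (length (y ∷ ys)) gk≤gx))

-- x + y ≡ k (mod n) for residues in Fin n; as x + y < 2n this means
-- x + y = k or x + y = k + n.
AddsTo : ∀ {n} → Fin n → Fin n → Fin n → Set
AddsTo {n} k x y = toℕ x + toℕ y ≡ toℕ k ⊎ toℕ x + toℕ y ≡ toℕ k + n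

addsTo-sym : ∀ {n} {k x y : Fin n} → AddsTo k x y → AddsTo k y x
addsTo-sym {x = x} {y} = Sum.map (trans (+-comm (toℕ y) (toℕ x))) (trans (+-comm (toℕ y) (toℕ x)))

addsTo-unique : ∀ {n} {k x y y′ : Fin n} → AddsTo k x y → AddsTo k x y′ → y ≡ y′
addsTo-unique {n} {k} {x} {y} {y′} h h′ = toℕ-injective (go h h′)
  where
  cancel : ∀ {a b} → toℕ x + a ≡ toℕ x + b → a ≡ b
  cancel = +-cancelˡ-≡ (toℕ x) _ _
  -- x + y = k and x + y′ = k + n would force y′ = y + n ≥ n.
  wraps : ∀ {a b : Fin n} → toℕ x + toℕ a ≡ toℕ k → toℕ x + toℕ b ≡ toℕ k + n → ⊥
  wraps {a} {b} p q = <⇒≱ (toℕ<n b) (≤-trans (m≤n+m n (toℕ a)) (≤-reflexive (sym (cancel (begin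
    toℕ x + toℕ b       ≡⟨ q ⟩
    toℕ k + n           ≡⟨ cong (_+ n) p ⟨
    toℕ x + toℕ a + n   ≡⟨ +-assoc (toℕ x) (toℕ a) n ⟩
    toℕ x + (toℕ a + n) ∎)))))
    where open ≡-Reasoning
  go : AddsTo k x y → AddsTo k x y′ → toℕ y ≡ toℕ y′
  go (inj₁ p) (inj₁ q) = cancel (trans p (sym q))
  go (inj₂ p) (inj₂ q) = cancel (trans p (sym q))
  go (inj₁ p) (inj₂ q) = ⊥-elim (wraps p q)
  go (inj₂ p) (inj₁ q) = ⊥-elim (wraps q p)

reduce-by : ∀ {n} (a : ℕ) → a < n + n → Dec (a < n) → Fin n
reduce-by a a<2n (yes a<n) = fromℕ< a<n
reduce-by {n} a a<2n (no a≮n) =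
  fromℕ< (+-cancelʳ-< _ _ n (subst (_< n + n) (sym (m∸n+n≡m (≮⇒≥ a≮n))) a<2n))

reduce : ∀ {n} (a : ℕ) → a < n + n → Fin n
reduce {n} a a<2n = reduce-by a a<2n (a <? n)

reduce-spec : ∀ {n} (a : ℕ) (a<2n : a < n + n) → toℕ (reduce a a<2n) ≡ a ⊎ toℕ (reduce a a<2n) + n ≡ a
reduce-spec {n} a a<2n = by-cases (a <? n)
  where
  by-cases : (d : Dec (a < n)) → toℕ (reduce-by a a<2n d) ≡ a ⊎ toℕ (reduce-by a a<2n d) + n ≡ a
  by-cases (yes a<n) = inj₁ (toℕ-fromℕ< a<n)
  by-cases (no a≮n)  = inj₂ (trans (cong (_+ n) (toℕ-fromℕ< _)) (m∸n+n≡m (≮⇒≥ a≮n)))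

-- The residue of a + b.
midpoint : ∀ {n} → Fin n → Fin n → Fin n
midpoint a b = reduce (toℕ a + toℕ b) (+-mono-< (toℕ<n a) (toℕ<n b))

midpoint-addsTo : ∀ {n} (a b : Fin n) → AddsTo (midpoint a b) a b
midpoint-addsTo a b = Sum.map sym sym (reduce-spec (toℕ a + toℕ b) _)

reflect-bound : ∀ {n} (k x : Fin n) → toℕ k + n ∸ toℕ x < n + n
reflect-bound {n} k x = ≤-<-trans (m∸n≤m (toℕ k + n) (toℕ x)) (+-monoˡ-< n (toℕ<n k))

reflect : ∀ {n} → Fin n → Fin n → Fin n
reflect {n} k x = reduce (toℕ k + n ∸ toℕ x) (reflect-bound k x)

reflect-addsTo : ∀ {n} (k x : Fin n) → AddsTo k x (reflect k x)
reflect-addsTo {n} k x = from-spec (reduce-spec (toℕ k + n ∸ toℕ x) (reflect-bound k x))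
  where
  y : Fin n
  y = reflect k x
  x+[k+n∸x]≡k+n : toℕ x + (toℕ k + n ∸ toℕ x) ≡ toℕ k + n
  x+[k+n∸x]≡k+n = m+[n∸m]≡n (≤-trans (<⇒≤ (toℕ<n x)) (m≤n+m n (toℕ k)))
  from-spec : toℕ y ≡ toℕ k + n ∸ toℕ x ⊎ toℕ y + n ≡ toℕ k + n ∸ toℕ x → AddsTo k x y
  from-spec (inj₁ y≡) = inj₂ (trans (cong (toℕ x +_) y≡) x+[k+n∸x]≡k+n)
  from-spec (inj₂ y+n≡) = inj₁ (+-cancelʳ-≡ n _ _ (begin
    toℕ x + toℕ y + n           ≡⟨ +-assoc (toℕ x) (toℕ y) n ⟩
    toℕ x + (toℕ y + n)         ≡⟨ cong (toℕ x +_) y+n≡ ⟩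
    toℕ x + (toℕ k + n ∸ toℕ x) ≡⟨ x+[k+n∸x]≡k+n ⟩
    toℕ k + n                   ∎))
    where open ≡-Reasoning

reflect-unique : ∀ {n} {k x y : Fin n} → AddsTo k x y → reflect k x ≡ y
reflect-unique {k = k} {x} = addsTo-unique (reflect-addsTo k x)

reflect-involutive : ∀ {n} (k x : Fin n) → reflect k (reflect k x) ≡ x
reflect-involutive k x = reflect-unique {k = k} {reflect k x} (addsTo-sym {k = k} {x} {reflect k x} (reflect-addsTo k x))

reflection : ∀ {n} → Fin n → Permutation′ n
reflection k = permutation (reflect k) (reflect k) (reflect-involutive k) (reflect-involutive k)

Pair : ℕ → Set
Pair n = Fin n × Fin n

_≟ₚ_ : ∀ {n} → DecidableEquality (Pair n)
_≟ₚ_ = ≡-dec Fin._≟_ Fin._≟_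

orient-by : ∀ {n} (x y : Fin n) → Dec (x Fin.< y) → Pair n
orient-by x y (yes _) = x , y
orient-by x y (no _)  = y , x

orient : ∀ {n} → Pair n → Pair n
orient (x , y) = orient-by x y (x FinP.<? y)

orient-cases : ∀ {n} (x y : Fin n) → orient (x , y) ≡ (x , y) ⊎ orient (x , y) ≡ (y , x)
orient-cases x y with x FinP.<? y
... | yes _ = inj₁ refl
... | no _  = inj₂ refl

orient-ordered : ∀ {n} {x y : Fin n} → x Fin.< y → orient (x , y) ≡ (x , y)
orient-ordered {x = x} {y} x<y with x FinP.<? y
... | yes _   = refl
... | no x≮y = ⊥-elim (x≮y x<y)

orient-reversed : ∀ {n} {x y : Fin n} → x Fin.< y → orient (y , x) ≡ (x , y)
orient-reversed {x = x} {y} x<y with y FinP.<? x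
... | yes y<x = ⊥-elim (FinP.<-asym x<y y<x)
... | no _    = refl

∈ₑ-swap : ∀ {n} {x y : Fin n} {K : List (Pair n)} → (x , y) ∈ₑ K → (y , x) ∈ₑ K
∈ₑ-swap = Sum.swap

orient-∈ₑ : ∀ {n} {x y : Fin n} {K : List (Pair n)} → orient (x , y) ∈ K → (x , y) ∈ₑ K
orient-∈ₑ {x = x} {y} {K} o∈K with orient-cases x y
... | inj₁ o≡xy = inj₁ (subst (_∈ K) o≡xy o∈K)
... | inj₂ o≡yx = inj₂ (subst (_∈ K) o≡yx o∈K)

map-unique : ∀ {a b} {A : Set a} {B : Set b} (f : A → B) {xs : List A} →
             (∀ {x y} → x ∈ xs → y ∈ xs → f x ≡ f y → x ≡ y) → Unique xs → Unique (map f xs)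
map-unique f {[]}     inj []          = []
map-unique f {x ∷ xs} inj (x∉xs ∷ u) =
  All.map⁺ (All.tabulate fx≢) ∷ map-unique f (λ p q → inj (there p) (there q)) u
  where
  fx≢ : ∀ {y} → y ∈ xs → f x ≢ f y
  fx≢ y∈xs fx≡fy = All.lookup x∉xs y∈xs (inj (here refl) (there y∈xs) fx≡fy)

module Image {n} (σ : Permutation′ n) where

  σ-injective : ∀ {x y} → σ ⟨$⟩ʳ x ≡ σ ⟨$⟩ʳ y → x ≡ y
  σ-injective {x} {y} σx≡σy = trans (sym (inverseˡ σ)) (trans (cong (σ ⟨$⟩ˡ_) σx≡σy) (inverseˡ σ))

  image : Pair n → Pair n
  image (u , v) = orient (σ ⟨$⟩ʳ u , σ ⟨$⟩ʳ v)

  σ-injective₂ : ∀ {u v a b} → (σ ⟨$⟩ʳ u , σ ⟨$⟩ʳ v) ≡ (σ ⟨$⟩ʳ a , σ ⟨$⟩ʳ b) → (u , v) ≡ (a , b)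
  σ-injective₂ eq = cong₂ _,_ (σ-injective (cong proj₁ eq)) (σ-injective (cong proj₂ eq))

  preimage : ∀ {H u v} (e : Pair n) → e ∈ H → (σ ⟨$⟩ʳ u , σ ⟨$⟩ʳ v) ≡ image e → (u , v) ∈ₑ H
  preimage {H} (a , b) e∈H eq with orient-cases (σ ⟨$⟩ʳ a) (σ ⟨$⟩ʳ b)
  ... | inj₁ o≡ = inj₁ (subst (_∈ H) (sym (σ-injective₂ (trans eq o≡))) e∈H)
  ... | inj₂ o≡ = inj₂ (subst (_∈ H) (sym (cong swap (σ-injective₂ (trans eq o≡)))) e∈H)

  image-isomorphic : (H : List (Pair n)) → Isomorphic H (map image H)
  image-isomorphic H = σ , λ u v → mk⇔ (forward u v) (backward u v)
    where
    forward₁ : ∀ u v → (u , v) ∈ H → (σ ⟨$⟩ʳ u , σ ⟨$⟩ʳ v) ∈ₑ map image H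
    forward₁ u v uv∈H = orient-∈ₑ (∈-map⁺ image uv∈H)
    forward : ∀ u v → (u , v) ∈ₑ H → (σ ⟨$⟩ʳ u , σ ⟨$⟩ʳ v) ∈ₑ map image H
    forward u v (inj₁ uv∈H) = forward₁ u v uv∈H
    forward u v (inj₂ vu∈H) = ∈ₑ-swap (forward₁ v u vu∈H)
    backward₁ : ∀ u v → (σ ⟨$⟩ʳ u , σ ⟨$⟩ʳ v) ∈ map image H → (u , v) ∈ₑ H
    backward₁ u v m with ∈-map⁻ image m
    ... | e , e∈H , eq = preimage e e∈H eq
    backward : ∀ u v → (σ ⟨$⟩ʳ u , σ ⟨$⟩ʳ v) ∈ₑ map image H → (u , v) ∈ₑ H
    backward u v (inj₁ m) = backward₁ u v m
    backward u v (inj₂ m) = ∈ₑ-swap (backward₁ v u m)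

_<ₗ_ : ∀ {n} → Rel (Pair n) 0ℓ
_<ₗ_ = ×-Lex _≡_ Fin._<_ Fin._<_

_<ₗ?_ : ∀ {n} → Decidable₂ (_<ₗ_ {n})
_<ₗ?_ = ×-decidable Fin._≟_ FinP._<?_ FinP._<?_

<ₗ-asym : ∀ {n} → Asymmetric (_<ₗ_ {n})
<ₗ-asym = ×-asymmetric {_≈₁_ = _≡_} {_<₁_ = Fin._<_} {_<₂_ = Fin._<_} sym (resp₂ Fin._<_) FinP.<-asym FinP.<-asym

<ₗ-distinct : ∀ {n} (e f : Pair n) → e ≢ f → e <ₗ f ⊎ f <ₗ e
<ₗ-distinct {n} e f e≢f with ×-compare {_≈₂_ = _≡_} sym (FinP.<-cmp {n}) (FinP.<-cmp {n}) e f
... | tri< e<f _ _ = inj₁ e<f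
... | tri≈ _ e≋f _ = ⊥-elim (e≢f (≡×≡⇒≡ e≋f))
... | tri> _ _ f<e = inj₂ f<e

larger-of : ∀ {p} {P : ℕ → Set p} a b → P a → P b → ∃[ s ] P s × a + b ≤ 2 * s
larger-of a b pa pb with ≤-total a b
... | inj₁ a≤b = b , pb , ≤-trans (+-monoˡ-≤ b a≤b) (≤-reflexive (cong (b +_) (sym (+-identityʳ b))))
... | inj₂ b≤a = a , pa , ≤-trans (+-monoʳ-≤ a b≤a) (≤-reflexive (cong (a +_) (sym (+-identityʳ a))))

-- An involution σ of the vertex set pairs up the edges e of G that σ moves to
-- another edge.  Keeping from each such pair {e , σ e} the edge that is first
-- in some fixed orientation gives a subgraph H which is edge-disjoint from
-- and isomorphic (via σ) to its image.
module Involution {n} (G : Graph n) (σ : Permutation′ n)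
                  (σ-involutive : ∀ x → σ ⟨$⟩ʳ (σ ⟨$⟩ʳ x) ≡ x) where
  open Image σ
  open import Data.List.Membership.DecPropositional (_≟ₚ_ {n}) using (_∈?_)

  image-involutive : ∀ {e} → e ∈ edges G → image (image e) ≡ e
  image-involutive {a , b} e∈G with orient-cases (σ ⟨$⟩ʳ a) (σ ⟨$⟩ʳ b)
  ... | inj₁ o≡ = begin
    image (orient (σ ⟨$⟩ʳ a , σ ⟨$⟩ʳ b)) ≡⟨ cong image o≡ ⟩
    orient (σ ⟨$⟩ʳ (σ ⟨$⟩ʳ a) , σ ⟨$⟩ʳ (σ ⟨$⟩ʳ b)) ≡⟨ cong₂ (λ x y → orient (x , y)) (σ-involutive a) (σ-involutive b) ⟩
    orient (a , b) ≡⟨ orient-ordered (All.lookup (ordered G) e∈G) ⟩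
    (a , b) ∎
    where open ≡-Reasoning
  ... | inj₂ o≡ = begin
    image (orient (σ ⟨$⟩ʳ a , σ ⟨$⟩ʳ b)) ≡⟨ cong image o≡ ⟩
    orient (σ ⟨$⟩ʳ (σ ⟨$⟩ʳ b) , σ ⟨$⟩ʳ (σ ⟨$⟩ʳ a)) ≡⟨ cong₂ (λ x y → orient (x , y)) (σ-involutive b) (σ-involutive a) ⟩
    orient (b , a) ≡⟨ orient-reversed (All.lookup (ordered G) e∈G) ⟩
    (a , b) ∎
    where open ≡-Reasoning

  module Oriented {r} (R : Rel (Pair n) r) (R? : Decidable₂ R) (R-asym : Asymmetric R) where
    Chosen : Pair n → Set r
    Chosen e = image e ∈ edges G × R e (image e)

    chosen? : Decidable Chosen
    chosen? e = (image e ∈? edges G) ×-dec R? e (image e)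

    H : List (Pair n)
    H = filter chosen? (edges G)

    H⊆G : ∀ {e} → e ∈ H → e ∈ edges G
    H⊆G e∈H = proj₁ (∈-filter⁻ chosen? {xs = edges G} e∈H)

    H-chosen : ∀ {e} → e ∈ H → Chosen e
    H-chosen e∈H = proj₂ (∈-filter⁻ chosen? {xs = edges G} e∈H)

    H-unique : Unique H
    H-unique = filter⁺ chosen? (unique G)

    image-unique : Unique (map image H)
    image-unique = map-unique image image-injective H-unique
      where
      image-injective : ∀ {e f} → e ∈ H → f ∈ H → image e ≡ image f → e ≡ f
      image-injective e∈H f∈H eq =
        trans (sym (image-involutive (H⊆G e∈H))) (trans (cong image eq) (image-involutive (H⊆G f∈H)))

    image⊆G : ∀ {f} → f ∈ map image H → f ∈ edges G
    image⊆G f∈ with ∈-map⁻ image f∈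
    ... | e , e∈H , refl = proj₁ (H-chosen e∈H)

    -- An edge f = image e of H in H would satisfy both R e f and R f e.
    disjoint : ∀ {f} → f ∈ H → f ∉ map image H
    disjoint f∈H f∈ with ∈-map⁻ image f∈
    ... | e , e∈H , refl =
      R-asym (proj₂ (H-chosen e∈H)) (subst (R (image e)) (image-involutive (H⊆G e∈H)) (proj₂ (H-chosen f∈H)))

    isoPair : HasIsoPair G (length H)
    isoPair = H , map image H , (H-unique , All.tabulate H⊆G) , (image-unique , All.tabulate image⊆G)
            , All.tabulate disjoint , image-isomorphic H , refl , length-map image H

  module Up   = Oriented _<ₗ_ _<ₗ?_ <ₗ-asym
  module Down = Oriented (flip _<ₗ_) (flip _<ₗ?_) (flip <ₗ-asym)

  moved : Pair n → ℕ
  moved e = 𝟙 (image e ∈? edges G) * 𝟙 (¬? (image e ≟ₚ e))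

  -- Every moved edge is chosen by the lexicographic order or by its reverse,
  -- so some iso pair has at least half as many edges as there are moved edges.
  moved-bound : ∃[ s ] HasIsoPair G s × ∑ (edges G) moved ≤ 2 * s
  moved-bound with larger-of (length Up.H) (length Down.H) Up.isoPair Down.isoPair
  ... | s , pair , up+down≤2s = s , pair , ≤-trans moved≤up+down up+down≤2s
    where
    moved≤ : ∀ e → moved e ≤ 𝟙 (Up.chosen? e) + 𝟙 (Down.chosen? e)
    moved≤ e = ≤-trans (≤-reflexive (sym (𝟙-× (image e ∈? edges G) (¬? (image e ≟ₚ e)))))
      (𝟙-⊎ _ (Up.chosen? e) (Down.chosen? e)
        (λ (e′∈G , e′≢e) → Sum.map (e′∈G ,_) (e′∈G ,_) (<ₗ-distinct e (image e) (e′≢e ∘ sym))))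
    moved≤up+down : ∑ (edges G) moved ≤ length Up.H + length Down.H
    moved≤up+down = begin
      ∑ (edges G) moved ≤⟨ ∑-mono (edges G) (λ e _ → moved≤ e) ⟩
      ∑ (edges G) (λ e → 𝟙 (Up.chosen? e) + 𝟙 (Down.chosen? e)) ≡⟨ ∑-+ (edges G) _ _ ⟩
      ∑ (edges G) (λ e → 𝟙 (Up.chosen? e)) + ∑ (edges G) (λ e → 𝟙 (Down.chosen? e))
        ≡⟨ cong₂ _+_ (length-filter Up.chosen? (edges G)) (length-filter Down.chosen? (edges G)) ⟨
      length Up.H + length Down.H ∎
      where open ≤-Reasoning

∸-cross : ∀ {u v u′ v′} → u ≤ v → u′ ≤ v′ → v ∸ u ≡ v′ ∸ u′ → v + u′ ≡ u + v′
∸-cross {u} {v} {u′} {v′} u≤v u′≤v′ eq = begin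
  v + u′                 ≡⟨ cong (_+ u′) (m∸n+n≡m u≤v) ⟨
  v ∸ u + u + u′         ≡⟨ cong (λ d → d + u + u′) eq ⟩
  v′ ∸ u′ + u + u′       ≡⟨ cong (_+ u′) (+-comm (v′ ∸ u′) u) ⟩
  u + (v′ ∸ u′) + u′     ≡⟨ +-assoc u (v′ ∸ u′) u′ ⟩
  u + (v′ ∸ u′ + u′)     ≡⟨ cong (u +_) (m∸n+n≡m u′≤v′) ⟩
  u + v′                 ∎
  where open ≡-Reasoning

-- Edges are grouped by their difference v − u; m² ≤ n·S by Cauchy–Schwarz,
-- where S counts pairs of edges with equal difference, and each such pair
-- e ≠ f is exchanged by a reflection, so S ≤ T + m with T the total number
-- of edges moved onto other edges by the n reflections.
module Counting {n} (G : Graph n) where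
  open import Data.List.Membership.DecPropositional (_≟ₚ_ {n}) using (_∈?_)

  E : List (Pair n)
  E = edges G

  m : ℕ
  m = numEdges G

  image : Fin n → Pair n → Pair n
  image k = Image.image (reflection k)

  moved : Fin n → Pair n → ℕ
  moved k = Involution.moved G (reflection k) (reflect-involutive k)

  T : ℕ
  T = ∑ (allFin n) (λ k → ∑ E (moved k))

  difference : Pair n → Fin n
  difference (u , v) = fromℕ< (≤-<-trans (m∸n≤m (toℕ v) (toℕ u)) (toℕ<n v))

  -- Edges with the same difference are mirror images under the reflection
  -- x ↦ (u + v′) − x.
  mirror : Pair n → Pair n → Fin n
  mirror (u , _) (_ , v′) = midpoint u v′

  mirror-image : ∀ {e f} → e ∈ E → f ∈ E → difference e ≡ difference f → image (mirror e f) e ≡ f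
  mirror-image {u , v} {u′ , v′} e∈E f∈E eq = begin
    orient (reflect k u , reflect k v) ≡⟨ cong₂ (λ x y → orient (x , y)) u↦v′ v↦u′ ⟩
    orient (v′ , u′)                   ≡⟨ orient-reversed u′<v′ ⟩
    (u′ , v′)                          ∎
    where
    open ≡-Reasoning
    k : Fin n
    k = midpoint u v′
    u<v : u Fin.< v
    u<v = All.lookup (ordered G) e∈E
    u′<v′ : u′ Fin.< v′
    u′<v′ = All.lookup (ordered G) f∈E
    v+u′≡u+v′ : toℕ v + toℕ u′ ≡ toℕ u + toℕ v′
    v+u′≡u+v′ = ∸-cross (<⇒≤ u<v) (<⇒≤ u′<v′)
      (trans (sym (toℕ-fromℕ< _)) (trans (cong toℕ eq) (toℕ-fromℕ< _)))
    u↦v′ : reflect k u ≡ v′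
    u↦v′ = reflect-unique (midpoint-addsTo u v′)
    v↦u′ : reflect k v ≡ u′
    v↦u′ = reflect-unique (subst (λ s → s ≡ toℕ k ⊎ s ≡ toℕ k + n) (sym v+u′≡u+v′) (midpoint-addsTo u v′))

  classSize : Fin n → ℕ
  classSize δ = ∑ E (λ f → 𝟙 (δ Fin.≟ difference f))

  S : ℕ
  S = ∑ E (λ e → ∑ E (λ f → 𝟙 (difference e Fin.≟ difference f)))

  -- Every edge lies in its own class (the classes in fact partition E).
  m≤∑classSize : m ≤ ∑ (allFin n) classSize
  m≤∑classSize = begin
    m                                                           ≡⟨ ∑-one E ⟨
    ∑ E (λ _ → 1)                                               ≤⟨ ∑-mono E (λ f _ → own-class f) ⟩
    ∑ E (λ f → ∑ (allFin n) (λ δ → 𝟙 (δ Fin.≟ difference f))) ≡⟨ ∑-swap E (allFin n) _ ⟩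
    ∑ (allFin n) classSize                                      ∎
    where
    open ≤-Reasoning
    own-class : ∀ f → 1 ≤ ∑ (allFin n) (λ δ → 𝟙 (δ Fin.≟ difference f))
    own-class f = ≤-trans (≤-reflexive (sym (𝟙-yes (difference f Fin.≟ difference f) refl)))
                          (∑-pick (allFin n) _ (∈-allFin (difference f)))

  -- ∑ a_δ² counts pairs of edges in a common class.
  ∑classSize²≤S : ∑ (allFin n) (λ δ → classSize δ * classSize δ) ≤ S
  ∑classSize²≤S = begin
    ∑ (allFin n) (λ δ → classSize δ * classSize δ)
      ≡⟨ ∑-cong (allFin n) (λ δ → ∑-*ʳ E (λ e → 𝟙 (δ Fin.≟ difference e)) (classSize δ)) ⟩
    ∑ (allFin n) (λ δ → ∑ E (λ e → 𝟙 (δ Fin.≟ difference e) * classSize δ))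
      ≡⟨ ∑-swap E (allFin n) _ ⟨
    ∑ E (λ e → ∑ (allFin n) (λ δ → 𝟙 (δ Fin.≟ difference e) * classSize δ))
      ≤⟨ ∑-mono E (λ e _ → ∑-delta Fin._≟_ (allFin n) (allFin⁺ n) (difference e) classSize) ⟩
    ∑ E (λ e → 𝟙 (difference e ∈ᶠ? allFin n) * classSize (difference e))
      ≤⟨ ∑-mono E (λ e _ → *-monoˡ-≤ (classSize (difference e)) (𝟙≤1 (difference e ∈ᶠ? allFin n))) ⟩
    ∑ E (λ e → 1 * classSize (difference e))
      ≡⟨ ∑-cong E (λ e → *-identityˡ (classSize (difference e))) ⟩
    S ∎
    where
    open ≤-Reasoning
    open import Data.List.Membership.DecPropositional (Fin._≟_ {n}) using () renaming (_∈?_ to _∈ᶠ?_)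

  distinct-pairs≤T : ∑ E (λ e → ∑ E (λ f → 𝟙 (difference e Fin.≟ difference f) * 𝟙 (¬? (f ≟ₚ e)))) ≤ T
  distinct-pairs≤T = begin
    ∑ E (λ e → ∑ E (λ f → 𝟙 (difference e Fin.≟ difference f) * 𝟙 (¬? (f ≟ₚ e))))
      ≤⟨ ∑-mono E (λ e e∈E → ∑-mono E (λ f f∈E → some-reflection e∈E f∈E)) ⟩
    ∑ E (λ e → ∑ E (λ f → ∑ (allFin n) (λ k → reflects k e f)))
      ≡⟨ ∑-cong E (λ e → ∑-swap E (allFin n) (λ f k → reflects k e f)) ⟩
    ∑ E (λ e → ∑ (allFin n) (λ k → ∑ E (reflects k e)))
      ≡⟨ ∑-swap E (allFin n) (λ e k → ∑ E (reflects k e)) ⟩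
    ∑ (allFin n) (λ k → ∑ E (λ e → ∑ E (reflects k e)))
      ≤⟨ ∑-mono (allFin n) (λ k _ → ∑-mono E (λ e _ →
           ∑-delta _≟ₚ_ E (unique G) (image k e) (λ f → 𝟙 (¬? (f ≟ₚ e))))) ⟩
    T ∎
    where
    open ≤-Reasoning
    reflects : Fin n → Pair n → Pair n → ℕ
    reflects k e f = 𝟙 (f ≟ₚ image k e) * 𝟙 (¬? (f ≟ₚ e))
    some-reflection : ∀ {e f} → e ∈ E → f ∈ E →
      𝟙 (difference e Fin.≟ difference f) * 𝟙 (¬? (f ≟ₚ e)) ≤ ∑ (allFin n) (λ k → reflects k e f)
    some-reflection {e} {f} e∈E f∈E = ≤-trans
      (*-monoˡ-≤ (𝟙 (¬? (f ≟ₚ e)))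
        (𝟙-mono (difference e Fin.≟ difference f) (f ≟ₚ image (mirror e f) e)
                (λ eq → sym (mirror-image e∈E f∈E eq))))
      (∑-pick (allFin n) (λ k → reflects k e f) (∈-allFin (mirror e f)))

  diagonal≤m : ∑ E (λ e → ∑ E (λ f → 𝟙 (f ≟ₚ e))) ≤ m
  diagonal≤m = begin
    ∑ E (λ e → ∑ E (λ f → 𝟙 (f ≟ₚ e)))        ≡⟨ ∑-cong E (λ e → ∑-cong E (λ f → *-identityʳ (𝟙 (f ≟ₚ e)))) ⟨
    ∑ E (λ e → ∑ E (λ f → 𝟙 (f ≟ₚ e) * 1))    ≤⟨ ∑-mono E (λ e _ → ∑-delta _≟ₚ_ E (unique G) e (λ _ → 1)) ⟩
    ∑ E (λ e → 𝟙 (e ∈? E) * 1)                ≤⟨ ∑-mono E (λ e _ → ≤-trans (≤-reflexive (*-identityʳ _)) (𝟙≤1 (e ∈? E))) ⟩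
    ∑ E (λ _ → 1)                             ≡⟨ ∑-one E ⟩
    m                                         ∎
    where open ≤-Reasoning

  S≤T+m : S ≤ T + m
  S≤T+m = begin
    S ≤⟨ ∑-mono E (λ e _ → ∑-mono E (λ f _ → 𝟙-split (difference e Fin.≟ difference f) (f ≟ₚ e))) ⟩
    ∑ E (λ e → ∑ E (λ f → A e f + 𝟙 (f ≟ₚ e)))        ≡⟨ ∑-cong E (λ e → ∑-+ E (A e) (λ f → 𝟙 (f ≟ₚ e))) ⟩
    ∑ E (λ e → ∑ E (A e) + ∑ E (λ f → 𝟙 (f ≟ₚ e)))    ≡⟨ ∑-+ E _ _ ⟩
    ∑ E (λ e → ∑ E (A e)) + ∑ E (λ e → ∑ E (λ f → 𝟙 (f ≟ₚ e))) ≤⟨ +-mono-≤ distinct-pairs≤T diagonal≤m ⟩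
    T + m ∎
    where
    open ≤-Reasoning
    A : Pair n → Pair n → ℕ
    A e f = 𝟙 (difference e Fin.≟ difference f) * 𝟙 (¬? (f ≟ₚ e))

  m²≤n[T+m] : m * m ≤ n * (T + m)
  m²≤n[T+m] = begin
    m * m                                                   ≤⟨ *-mono-≤ m≤∑classSize m≤∑classSize ⟩
    ∑ (allFin n) classSize * ∑ (allFin n) classSize         ≤⟨ cauchy-schwarz (allFin n) classSize ⟩
    length (allFin n) * ∑ (allFin n) (λ δ → classSize δ * classSize δ)
      ≡⟨ cong (_* ∑ (allFin n) (λ δ → classSize δ * classSize δ)) (length-tabulate (id {A = Fin n})) ⟩
    n * ∑ (allFin n) (λ δ → classSize δ * classSize δ)      ≤⟨ *-monoʳ-≤ n (≤-trans ∑classSize²≤S S≤T+m) ⟩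
    n * (T + m)                                             ∎
    where open ≤-Reasoning

above-average : ∀ {n} (g : Fin (suc n) → ℕ) → ∃[ k ] ∑ (allFin (suc n)) g ≤ suc n * g k
above-average {n} g with ∑≤length*max Fin.zero (tabulate Fin.suc) g
... | k , ∑≤ = k , ≤-trans ∑≤ (≤-reflexive (cong (_* g k) (length-tabulate (id {A = Fin (suc n)}))))

-- Take the reflection moving the most edges: it moves at least T/n of them.
iso-pair-bound : ∀ {n} (G : Graph (suc n)) →
  ∃[ s ] HasIsoPair G s × numEdges G * numEdges G ≤ suc n * (suc n * (2 * s) + numEdges G)
iso-pair-bound {n} G = s , pair , (begin
  m * m                         ≤⟨ m²≤n[T+m] ⟩
  suc n * (T + m)               ≤⟨ *-monoʳ-≤ (suc n) (+-monoˡ-≤ m T≤n*2s) ⟩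
  suc n * (suc n * (2 * s) + m) ∎)
  where
  open Counting G
  open ≤-Reasoning
  busiest : ∃[ k ] T ≤ suc n * ∑ E (moved k)
  busiest = above-average (λ k → ∑ E (moved k))
  k : Fin (suc n)
  k = proj₁ busiest
  best : ∃[ s ] HasIsoPair G s × ∑ E (moved k) ≤ 2 * s
  best = Involution.moved-bound G (reflection k) (reflect-involutive k)
  s : ℕ
  s = proj₁ best
  pair : HasIsoPair G s
  pair = proj₁ (proj₂ best)
  T≤n*2s : T ≤ suc n * (2 * s)
  T≤n*2s = ≤-trans (proj₂ busiest) (*-monoʳ-≤ (suc n) (proj₂ (proj₂ best)))

dense-case : ∀ n m s → m * m ≤ n * (n * (2 * s) + m) → 5 * n ≤ 3 * m → m * m ≤ 5 * (n * n) * s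
dense-case n m s bound 5n≤3m = *-cancelˡ-≤ 2 (+-cancelʳ-≤ (3 * (m * m)) _ _ (begin
  2 * (m * m) + 3 * (m * m)           ≡⟨ split-5 m ⟩
  5 * (m * m)                         ≤⟨ *-monoʳ-≤ 5 bound ⟩
  5 * (n * (n * (2 * s) + m))         ≡⟨ expand n m s ⟩
  2 * (5 * (n * n) * s) + (5 * n) * m ≤⟨ +-monoʳ-≤ (2 * (5 * (n * n) * s)) (*-monoˡ-≤ m 5n≤3m) ⟩
  2 * (5 * (n * n) * s) + (3 * m) * m ≡⟨ cong (2 * (5 * (n * n) * s) +_) (*-assoc 3 m m) ⟩
  2 * (5 * (n * n) * s) + 3 * (m * m) ∎))
  where
  open ≤-Reasoning
  split-5 : ∀ m → 2 * (m * m) + 3 * (m * m) ≡ 5 * (m * m)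
  split-5 = solve-∀
  expand : ∀ n m s → 5 * (n * (n * (2 * s) + m)) ≡ 2 * (5 * (n * n) * s) + (5 * n) * m
  expand = solve-∀

-- With 3m < 5n already a single edge suffices: m² < (5n/3)² ≤ 5n².
sparse-case : ∀ n m → 3 * m < 5 * n → m * m ≤ 5 * (n * n) * 1
sparse-case n m 3m<5n = *-cancelˡ-≤ 9 (begin
  9 * (m * m)               ≡⟨ square-3 m ⟩
  (3 * m) * (3 * m)         ≤⟨ *-mono-≤ (<⇒≤ 3m<5n) (<⇒≤ 3m<5n) ⟩
  (5 * n) * (5 * n)         ≤⟨ ≤-reflexive (square-5 n) ⟩
  25 * (n * n) + 0          ≤⟨ +-monoʳ-≤ (25 * (n * n)) z≤n ⟩
  25 * (n * n) + 20 * (n * n) ≡⟨ collect n ⟩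
  9 * (5 * (n * n) * 1)     ∎)
  where
  open ≤-Reasoning
  square-3 : ∀ m → 9 * (m * m) ≡ (3 * m) * (3 * m)
  square-3 = solve-∀
  square-5 : ∀ n → (5 * n) * (5 * n) ≡ 25 * (n * n) + 0
  square-5 = solve-∀
  collect : ∀ n → 25 * (n * n) + 20 * (n * n) ≡ 9 * (5 * (n * n) * 1)
  collect = solve-∀

transpose-left : ∀ {n} (i j : Fin n) → PC.transpose i j i ≡ j
transpose-left i j with i Fin.≟ i
... | yes _   = refl
... | no i≢i = ⊥-elim (i≢i refl)

transpose-other : ∀ {n} {i j k : Fin n} → k ≢ i → k ≢ j → PC.transpose i j k ≡ k
transpose-other {i = i} {j} {k} k≢i k≢j with k Fin.≟ i
... | yes k≡i = ⊥-elim (k≢i k≡i)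
... | no _ with k Fin.≟ j
...   | yes k≡j = ⊥-elim (k≢j k≡j)
...   | no _    = refl

-- The symmetric group acts transitively on ordered pairs of distinct
-- vertices: first move a to c, then the image of b to d.
pair-permutation : ∀ {n} {a b c d : Fin n} → a ≢ b → c ≢ d →
                   Σ (Permutation′ n) λ σ → σ ⟨$⟩ʳ a ≡ c × σ ⟨$⟩ʳ b ≡ d
pair-permutation {a = a} {b} {c} {d} a≢b c≢d = σ , σa≡c , transpose-left b′ d
  where
  b′ : Fin _
  b′ = PC.transpose a c b
  σ : Permutation′ _
  σ = transpose a c ∘ₚ transpose b′ d
  c≢b′ : c ≢ b′
  c≢b′ c≡b′ = a≢b (Image.σ-injective (transpose a c) (trans (transpose-left a c) c≡b′))
  σa≡c : σ ⟨$⟩ʳ a ≡ c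
  σa≡c = trans (cong (PC.transpose b′ d) (transpose-left a c)) (transpose-other c≢b′ c≢d)

single-edge-pair : ∀ {n} (G : Graph n) {e f : Pair n} → e ∈ edges G → f ∈ edges G → e ≢ f → HasIsoPair G 1
single-edge-pair {n} G {a , b} {c , d} e∈G f∈G e≢f =
  (a , b) ∷ [] , (c , d) ∷ [] , ([] ∷ [] , e∈G ∷ []) , ([] ∷ [] , f∈G ∷ []) ,
  ((λ { (here e≡f) → e≢f e≡f }) ∷ []) ,
  subst (Isomorphic ((a , b) ∷ [])) (cong (_∷ []) image≡) (image-isomorphic ((a , b) ∷ [])) , refl , refl
  where
  c<d : c Fin.< d
  c<d = All.lookup (ordered G) f∈G
  moving : Σ (Permutation′ n) λ σ → σ ⟨$⟩ʳ a ≡ c × σ ⟨$⟩ʳ b ≡ d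
  moving = pair-permutation (FinP.<⇒≢ (All.lookup (ordered G) e∈G)) (FinP.<⇒≢ c<d)
  open Image (proj₁ moving)
  image≡ : image (a , b) ≡ (c , d)
  image≡ = trans (cong₂ (λ x y → orient (x , y)) (proj₁ (proj₂ moving)) (proj₂ (proj₂ moving))) (orient-ordered c<d)

two-distinct : ∀ {a} {A : Set a} (xs : List A) → Unique xs → 2 ≤ length xs →
               ∃[ x ] ∃[ y ] x ∈ xs × y ∈ xs × x ≢ y
two-distinct (x ∷ y ∷ _) ((x≢y ∷ _) ∷ _) _       = x , y , here refl , there (here refl) , x≢y
two-distinct (_ ∷ [])    _                (s≤s ())

corollary2p7 : (n : ℕ) (G : Graph n) → 20 ≤ numEdges G →
    Σ ℕ λ s → HasIsoPair G s × (numEdges G * numEdges G ≤ 5 * (n * n) * s)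
corollary2p7 n G 20≤m with two-distinct (edges G) (unique G) (≤-trans (s≤s (s≤s z≤n)) 20≤m)
corollary2p7 zero    G 20≤m | ((() , _) , _)
corollary2p7 (suc n) G 20≤m | (e , f , e∈G , f∈G , e≢f) with 5 * suc n ≤? 3 * numEdges G
... | yes 5n≤3m = let (s , pair , bound) = iso-pair-bound G in
                  s , pair , dense-case (suc n) (numEdges G) s bound 5n≤3m
... | no 5n≰3m  = 1 , single-edge-pair G e∈G f∈G e≢f , sparse-case (suc n) (numEdges G) (≰⇒> 5n≰3m)
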